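{- Let $z$ be the cycle structure of some isotopism in $S_n^3$ that is an autotopism of a non-empty partial Latin square of order $n$, let $\mathfrak{I}_z$ be the set of isotopisms of cycle structure $z$, let $P$ be a non-empty partial Latin square of order $n$, and let $s$ be a positive integer. For each point set $X\in\{[P],\ \mathcal{PLS}_{n,s},\ \mathcal{PLS}_n\}$ consider the incidence structure with point set $X$, block set $\mathfrak{I}_z$, in which a point $Q$ is incident with a block $\Theta$ iff $\Theta$ is an autotopism of $Q$. Then: (i) each of these three incidence structures is uniform, i.e. $|X\cap\mathcal{PLS}_\Theta|$ is the same for all $\Theta\in\mathfrak{I}_z$ (these common values are denoted $\Delta_{[P]}(z)$, $\Delta_s(z)$ and $\Delta_{\mathcal{P}}(z)$ respectively); (ii) in each of them all blocks have the same multiplicity; (iii) the incidence structure with point set $[P]$ is regular, i.e. $|\mathfrak{A}_Q\cap\mathfrak{I}_z|$ is the same for all $Q\in[P]$.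
   Context: A partial Latin square of order $n$ is an $n\times n$ array whose cells are empty or contain a symbol of $[n]$, each symbol at most once per row and column; $O(P)$ is its set of (row, column, symbol) triples of filled cells and $|P|=|O(P)|$ its size. $\mathcal{PLS}_n$ is the set of non-empty partial Latin squares of order $n$ and $\mathcal{PLS}_{n,s}$ its subset of those of size $s$. For $\Theta=(\alpha,\beta,\gamma)\in S_n^3$, $P^\Theta$ has $O(P^\Theta)=\{(\alpha(r),\beta(c),\gamma(s)):(r,c,s)\in O(P)\}$; $[P]=\{P^\Theta:\Theta\in S_n^3\}$ is the isotopism class of $P$; $\Theta$ is an autotopism of $P$ if $P^\Theta=P$; $\mathfrak{A}_P$ is the set of autotopisms of $P$ and $\mathcal{PLS}_\Theta$ the set of non-empty partial Latin squares having $\Theta$ as autotopism. The cycle structure of $\Theta$ is the triple of cycle structures of $\alpha,\beta,\gamma$. In an incidence structure, the multiplicity of a block $\Theta$ is the number of blocks $\Theta'$ incident with exactly the same set of points as $\Theta$. -}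

module Defs where

open import Data.Nat using (ℕ; zero; suc; _+_; _/_; _<_)
open import Data.Fin using (Fin; _≟_)
open import Data.Vec using (Vec; lookup)
open import Data.Maybe using (Maybe; just; nothing)
import Data.Maybe as Maybe
open import Data.Bool using (Bool; true; false; _∧_; not)
open import Data.List using (List; upTo; allFin; filter; length)
import Data.List
open import Data.Bool.ListAction using (all)
open import Data.Nat.ListAction using (sum)
open import Data.Product using (Σ; _×_; _,_)
open import Data.Unit using (⊤)
open import Data.Refinement using (Refinement; value)
open import Relation.Nullary.Decidable using (⌊_⌋)
open import Relation.Binary.PropositionalEquality using (_≡_)
open import Function.Bundles using (_↔_; _⇔_)

-- Permutations of [n] = Fin n, stored as the vector of images
-- (so that ≡ is extensional); the bijectivity proof is irrelevant.

IsPerm : {n : ℕ} → Vec (Fin n) n → Set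
IsPerm {n} v = ∀ (i j : Fin n) → lookup v i ≡ lookup v j → i ≡ j

Perm : ℕ → Set
Perm n = Refinement (Vec (Fin n) n) IsPerm

app : {n : ℕ} → Perm n → Fin n → Fin n
app p i = lookup (value p) i

iter : {n : ℕ} → Perm n → ℕ → Fin n → Fin n
iter p zero    x = x
iter p (suc k) x = app p (iter p k x)

_==_ : {n : ℕ} → Fin n → Fin n → Bool
x == y = ⌊ x ≟ y ⌋

inCycleOfLength : {n : ℕ} → Perm n → ℕ → Fin n → Bool
inCycleOfLength p m x =
  (iter p (suc m) x == x) ∧ all (λ k → not (iter p (suc k) x == x)) (upTo m)

countFin : (n : ℕ) → (Fin n → Bool) → ℕ
countFin n f = length (filter (λ x → f x Data.Bool.≟ true) (allFin n))

-- Cycle structure of p: for each m, the number of cycles of length (suc m).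
cycleStructure : {n : ℕ} → Perm n → ℕ → ℕ
cycleStructure {n} p m = countFin n (inCycleOfLength p m) / suc m

Isotopism : ℕ → Set
Isotopism n = Perm n × Perm n × Perm n

SameCycleStructure : {n : ℕ} → Isotopism n → Isotopism n → Set
SameCycleStructure (α , β , γ) (α' , β' , γ') =
  ∀ m → (cycleStructure α m ≡ cycleStructure α' m)
      × (cycleStructure β m ≡ cycleStructure β' m)
      × (cycleStructure γ m ≡ cycleStructure γ' m)

Array : ℕ → Set
Array n = Vec (Vec (Maybe (Fin n)) n) n

cell : {n : ℕ} → Array n → Fin n → Fin n → Maybe (Fin n)
cell A r c = lookup (lookup A r) c

IsPLS : {n : ℕ} → Array n → Set
IsPLS {n} A =
    (∀ (r c c' : Fin n) (s : Fin n) → cell A r c ≡ just s → cell A r c' ≡ just s → c ≡ c')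
  × (∀ (r r' c : Fin n) (s : Fin n) → cell A r c ≡ just s → cell A r' c ≡ just s → r ≡ r')

NonEmpty : {n : ℕ} → Array n → Set
NonEmpty {n} A = Σ (Fin n) λ r → Σ (Fin n) λ c → Σ (Fin n) λ s → cell A r c ≡ just s

PLS : ℕ → Set
PLS n = Refinement (Array n) (λ A → IsPLS A × NonEmpty A)

isFilled : {n : ℕ} → Maybe (Fin n) → Bool
isFilled (just _) = true
isFilled nothing  = false

size : {n : ℕ} → PLS n → ℕ
size {n} P =
  sum (Data.List.map (λ r → countFin n (λ c → isFilled (cell (value P) r c))) (allFin n))

-- Q = P^Θ, unfolded: O(Q) = {(α r, β c, γ s) : (r,c,s) ∈ O(P)}
-- (α, β bijective, so this determines every cell of Q)
IsIsotope : {n : ℕ} → Isotopism n → PLS n → PLS n → Set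
IsIsotope {n} (α , β , γ) P Q =
  ∀ (r c : Fin n) → cell (value Q) (app α r) (app β c) ≡ Maybe.map (app γ) (cell (value P) r c)

IsAutotopism : {n : ℕ} → Isotopism n → PLS n → Set
IsAutotopism Θ Q = IsIsotope Θ Q Q

InClass : {n : ℕ} → PLS n → PLS n → Set
InClass {n} P Q = Σ (Isotopism n) λ Θ → IsIsotope Θ P Q

HasSize : {n : ℕ} → ℕ → PLS n → Set
HasSize s Q = size Q ≡ s

AnyPLS : {n : ℕ} → PLS n → Set
AnyPLS _ = ⊤

-- Incidence structure: points = {Q ∈ PLS n ∣ X Q}, blocks = I_z,
-- where z is the cycle structure of a fixed isotopism Θ₀.

Iz : {n : ℕ} → Isotopism n → Set
Iz {n} Θ₀ = Refinement (Isotopism n) (λ Θ → SameCycleStructure Θ Θ₀)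

PointsOn : {n : ℕ} → (PLS n → Set) → Isotopism n → Set
PointsOn {n} X Θ = Refinement (PLS n) (λ Q → X Q × IsAutotopism Θ Q)

SameBlocks : {n : ℕ} → (PLS n → Set) → (Θ₀ : Isotopism n) → Isotopism n → Set
SameBlocks {n} X Θ₀ Θ =
  Refinement (Iz Θ₀) (λ Θ' → ∀ (Q : PLS n) → X Q → (IsAutotopism (value Θ') Q ⇔ IsAutotopism Θ Q))

BlocksOn : {n : ℕ} → (Θ₀ : Isotopism n) → PLS n → Set
BlocksOn Θ₀ Q = Refinement (Iz Θ₀) (λ Θ → IsAutotopism (value Θ) Q)

-- (i) uniform: |X ∩ PLS_Θ| independent of Θ ∈ 𝔍_z
-- (equal cardinality of finite sets = existence of a bijection)
Uniform : {n : ℕ} → (PLS n → Set) → Isotopism n → Set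
Uniform X Θ₀ = ∀ (Θ Θ' : Iz Θ₀) → PointsOn X (value Θ) ↔ PointsOn X (value Θ')

EqualMultiplicity : {n : ℕ} → (PLS n → Set) → Isotopism n → Set
EqualMultiplicity X Θ₀ = ∀ (Θ Θ' : Iz Θ₀) → SameBlocks X Θ₀ (value Θ) ↔ SameBlocks X Θ₀ (value Θ')

Regular : {n : ℕ} → (PLS n → Set) → Isotopism n → Set
Regular {n} X Θ₀ = ∀ (Q Q' : PLS n) → X Q → X Q' → BlocksOn Θ₀ Q ↔ BlocksOn Θ₀ Q'

-- Two isotopisms with the same cycle structure are conjugate, Θ′ = Φ Θ Φ⁻¹: in each component, match
-- the cycles of equal length of the two permutations and map each matched cycle onto its partner.
-- Conjugation by Φ permutes 𝔍_z, and Q ↦ Q^Φ permutes [P], PLS_{n,s} and PLS_n and carries the partial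
-- Latin squares with autotopism Θ onto those with autotopism Θ′. Together these bijections preserve
-- incidence, so neither the number of points on a block nor the multiplicity of a block depends on the
-- block. Dually, if Q′ = Q^Ψ then conjugation by Ψ maps 𝔄_Q ∩ 𝔍_z onto 𝔄_Q′ ∩ 𝔍_z, which gives regularity.

module Submission where

open import Defs
open import Data.Nat using (ℕ; _<_)
open import Data.Product using (Σ; _×_)
open import Data.Refinement using (value)

open import Data.Bool using (Bool; true; false; T; not; _∧_; if_then_else_)
import Data.Bool as Bool
open import Data.Bool.Properties using (T-∧; T-irrelevant)
open import Data.Empty using (⊥-elim)
open import Data.Fin using (Fin; Fin′; zero; suc; toℕ; inject; punchOut)
import Data.Fin as Fin
open import Data.Fin.Permutation using (permutation; ↔⇒≡)
import Data.Fin.Properties as Fin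
open import Data.Irrelevant using ([_])
import Data.Irrelevant as Irrelevant
open import Data.List using (List; []; _∷_; find; allFin; upTo)
import Data.List as List
open import Data.List.Membership.Propositional.Properties using (∈-allFin)
import Data.List.Properties as List
open import Data.List.Relation.Unary.All.Properties using (all⁺; all⁻; applyUpTo⁺₁; applyUpTo⁻)
open import Data.List.Relation.Unary.Any using (Any)
import Data.List.Relation.Unary.Any as Any
open import Data.Maybe using (Maybe; just; nothing; fromMaybe)
import Data.Maybe as Maybe
import Data.Maybe.Properties as Maybe
open import Data.Nat using (zero; suc; _+_; _*_; _∸_; _/_; _%_; _≤_; s≤s⁻¹)
open import Data.Nat.DivMod using (m≡m%n+[m/n]*n; m%n<n; m<n⇒m%n≡m; m*n/n≡m)
open import Data.Nat.ListAction using () renaming (sum to listSum)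
import Data.Nat.Properties as ℕ
open import Algebra.Properties.CommutativeMonoid.Sum ℕ.+-0-commutativeMonoid using (sum; sum-permute; sum-cong-≗)
open import Data.Product using (_,_; proj₁; proj₂; ∃)
import Data.Product as Product
open import Data.Product.Function.NonDependent.Propositional using (_×-↔_)
open import Data.Refinement using (proof; value-injective) renaming (_,_ to _⟨_⟩)
open import Data.Sum using (_⊎_; inj₁; inj₂)
open import Data.Sum.Function.Propositional using (_⊎-↔_)
open import Data.Unit using (tt)
open import Data.Vec using (lookup; tabulate)
open import Data.Vec.Properties using (lookup∘tabulate; tabulate∘lookup; tabulate-cong)
open import Function using (_∘_; id; Injective)
open import Function.Bundles using (_⇔_; _↔_; mk⇔; mk↔ₛ′; Equivalence; Inverse)
open import Function.Construct.Composition using (_↔-∘_; _⇔-∘_)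
open import Function.Construct.Identity using (↔-id)
open import Function.Construct.Symmetry using (↔-sym; ⇔-sym)
open import Relation.Binary.Definitions using (tri<; tri≈; tri>)
open import Relation.Binary.PropositionalEquality
open import Relation.Nullary using (Dec; yes; no; ¬_; ¬?)
open import Relation.Nullary.Decidable
  using (recompute; decidable-stable; does-⇔; map′; toWitness; fromWitness; toWitnessFalse; fromWitnessFalse)
open import Relation.Nullary.Negation using (contradiction)
open import Relation.Unary using (Decidable)

module _ {n : ℕ} where

  app-injective : (p : Perm n) → Injective _≡_ _≡_ (app p)
  app-injective (_ ⟨ [ injective ] ⟩) {i} {j} eq = recompute (i Fin.≟ j) (injective i j eq)

app-surjective : {n : ℕ} (p : Perm n) (y : Fin n) → ∃ λ x → app p x ≡ y
app-surjective {suc _} p y with Fin.any? (λ x → app p x Fin.≟ y)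
... | yes found = found
... | no ¬found = contradiction (Fin.injective⇒≤ avoid-injective) ℕ.1+n≰n
  where
  avoid : Fin _ → Fin _
  avoid x = punchOut {i = y} {j = app p x} (λ eq → ¬found (x , sym eq))
  avoid-injective : Injective _≡_ _≡_ avoid
  avoid-injective eq = app-injective p (Fin.punchOut-injective {i = y} _ _ eq)

module _ {n : ℕ} where

  fromLeftInverse : (f g : Fin n → Fin n) → (∀ x → g (f x) ≡ x) → Perm n
  fromLeftInverse f g g∘f≗id = tabulate f ⟨ [ injective ] ⟩
    where
    injective : IsPerm (tabulate f)
    injective i j eq = begin
      i                         ≡⟨ g∘f≗id i ⟨
      g (f i)                   ≡⟨ cong g (lookup∘tabulate f i) ⟨
      g (lookup (tabulate f) i) ≡⟨ cong g eq ⟩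
      g (lookup (tabulate f) j) ≡⟨ cong g (lookup∘tabulate f j) ⟩
      g (f j)                   ≡⟨ g∘f≗id j ⟩
      j                         ∎
      where open ≡-Reasoning

  Perm-ext : {p q : Perm n} → (∀ x → app p x ≡ app q x) → p ≡ q
  Perm-ext {p} {q} p≗q = value-injective (begin
    value p           ≡⟨ tabulate∘lookup (value p) ⟨
    tabulate (app p)  ≡⟨ tabulate-cong p≗q ⟩
    tabulate (app q)  ≡⟨ tabulate∘lookup (value q) ⟩
    value q           ∎)
    where open ≡-Reasoning

  infix 10 _⁻¹
  _⁻¹ : Perm n → Perm n
  p ⁻¹ = fromLeftInverse (proj₁ ∘ app-surjective p) (app p) (proj₂ ∘ app-surjective p)

  ⁻¹-inverseʳ : (p : Perm n) (y : Fin n) → app p (app (p ⁻¹) y) ≡ y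
  ⁻¹-inverseʳ p y = trans (cong (app p) (lookup∘tabulate (proj₁ ∘ app-surjective p) y)) (proj₂ (app-surjective p y))

  ⁻¹-inverseˡ : (p : Perm n) (x : Fin n) → app (p ⁻¹) (app p x) ≡ x
  ⁻¹-inverseˡ p x = app-injective p (⁻¹-inverseʳ p (app p x))

  infixr 9 _∘ₚ_
  _∘ₚ_ : Perm n → Perm n → Perm n
  p ∘ₚ q = fromLeftInverse (app p ∘ app q) (app (q ⁻¹) ∘ app (p ⁻¹)) cancel
    where
    cancel : ∀ x → app (q ⁻¹) (app (p ⁻¹) (app p (app q x))) ≡ x
    cancel x = trans (cong (app (q ⁻¹)) (⁻¹-inverseˡ p (app q x))) (⁻¹-inverseˡ q x)

  app-∘ₚ : (p q : Perm n) (x : Fin n) → app (p ∘ₚ q) x ≡ app p (app q x)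
  app-∘ₚ p q = lookup∘tabulate (app p ∘ app q)

  Intertwines : Perm n → Perm n → Perm n → Set
  Intertwines φ a b = ∀ x → app φ (app a x) ≡ app b (app φ x)

  conjugate : Perm n → Perm n → Perm n
  conjugate φ a = φ ∘ₚ a ∘ₚ φ ⁻¹

  intertwines-conjugate : (φ a : Perm n) → Intertwines φ a (conjugate φ a)
  intertwines-conjugate φ a x = sym (begin
    app (φ ∘ₚ a ∘ₚ φ ⁻¹) (app φ x)        ≡⟨ app-∘ₚ φ (a ∘ₚ φ ⁻¹) (app φ x) ⟩
    app φ (app (a ∘ₚ φ ⁻¹) (app φ x))     ≡⟨ cong (app φ) (app-∘ₚ a (φ ⁻¹) (app φ x)) ⟩
    app φ (app a (app (φ ⁻¹) (app φ x)))  ≡⟨ cong (app φ ∘ app a) (⁻¹-inverseˡ φ x) ⟩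
    app φ (app a x)                       ∎)
    where open ≡-Reasoning

  intertwines-⁻¹ : {φ a b : Perm n} → Intertwines φ a b ⇔ Intertwines (φ ⁻¹) b a
  intertwines-⁻¹ {φ} {a} {b} = mk⇔ forward backward
    where
    open ≡-Reasoning
    forward : Intertwines φ a b → Intertwines (φ ⁻¹) b a
    forward φa≡bφ y = begin
      app (φ ⁻¹) (app b y)                       ≡⟨ cong (app (φ ⁻¹) ∘ app b) (⁻¹-inverseʳ φ y) ⟨
      app (φ ⁻¹) (app b (app φ (app (φ ⁻¹) y)))  ≡⟨ cong (app (φ ⁻¹)) (φa≡bφ _) ⟨
      app (φ ⁻¹) (app φ (app a (app (φ ⁻¹) y)))  ≡⟨ ⁻¹-inverseˡ φ _ ⟩
      app a (app (φ ⁻¹) y)                       ∎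
    backward : Intertwines (φ ⁻¹) b a → Intertwines φ a b
    backward φ⁻¹b≡aφ⁻¹ x = begin
      app φ (app a x)                            ≡⟨ cong (app φ ∘ app a) (⁻¹-inverseˡ φ x) ⟨
      app φ (app a (app (φ ⁻¹) (app φ x)))       ≡⟨ cong (app φ) (φ⁻¹b≡aφ⁻¹ _) ⟨
      app φ (app (φ ⁻¹) (app b (app φ x)))       ≡⟨ ⁻¹-inverseʳ φ _ ⟩
      app b (app φ x)                            ∎

  intertwines-unique : {φ a b b′ : Perm n} → Intertwines φ a b → Intertwines φ a b′ → b ≡ b′
  intertwines-unique {φ} {a} {b} {b′} φa≡bφ φa≡b′φ = Perm-ext λ y → begin
    app b y                          ≡⟨ cong (app b) (⁻¹-inverseʳ φ y) ⟨
    app b (app φ (app (φ ⁻¹) y))     ≡⟨ φa≡bφ _ ⟨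
    app φ (app a (app (φ ⁻¹) y))     ≡⟨ φa≡b′φ _ ⟩
    app b′ (app φ (app (φ ⁻¹) y))    ≡⟨ cong (app b′) (⁻¹-inverseʳ φ y) ⟩
    app b′ y                         ∎
    where open ≡-Reasoning

  conjugate-⁻¹ˡ : (φ a : Perm n) → conjugate (φ ⁻¹) (conjugate φ a) ≡ a
  conjugate-⁻¹ˡ φ a = intertwines-unique {φ ⁻¹} {conjugate φ a}
    (intertwines-conjugate (φ ⁻¹) (conjugate φ a))
    (Equivalence.to (intertwines-⁻¹ {φ} {a} {conjugate φ a}) (intertwines-conjugate φ a))

  conjugate-⁻¹ʳ : (φ a : Perm n) → conjugate φ (conjugate (φ ⁻¹) a) ≡ a
  conjugate-⁻¹ʳ φ a = intertwines-unique {φ} {conjugate (φ ⁻¹) a}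
    (intertwines-conjugate φ (conjugate (φ ⁻¹) a))
    (Equivalence.from (intertwines-⁻¹ {φ} {conjugate (φ ⁻¹) a} {a}) (intertwines-conjugate (φ ⁻¹) a))

module _ {A : Set} {P : A → Set} where

  find-cong : {Q : A → Set} (P? : Decidable P) (Q? : Decidable Q) → (∀ x → P x ⇔ Q x) →
              ∀ xs → find P? xs ≡ find Q? xs
  find-cong P? Q? P⇔Q []       = refl
  find-cong P? Q? P⇔Q (x ∷ xs) =
    cong₂ (if_then just x else_) (does-⇔ (P⇔Q x) (P? x) (Q? x)) (find-cong P? Q? P⇔Q xs)

  find-just : (P? : Decidable P) {xs : List A} → Any P xs → ∃ λ z → find P? xs ≡ just z × P z
  find-just P? {x ∷ xs} some with P? x
  ... | yes px = x , refl , px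
  ... | no ¬px = find-just P? (Any.tail ¬px some)

T-injective : {a b : Bool} → T a ⇔ T b → a ≡ b
T-injective {false} {false} _   = refl
T-injective {false} {true}  a⇔b = ⊥-elim (Equivalence.from a⇔b _)
T-injective {true}  {false} a⇔b = ⊥-elim (Equivalence.to a⇔b _)
T-injective {true}  {true}  _   = refl

∃T-≡ : {A : Set} {f : A → Bool} {a b : ∃ (T ∘ f)} → proj₁ a ≡ proj₁ b → a ≡ b
∃T-≡ {a = x , s} {b = .x , t} refl = cong (x ,_) (T-irrelevant s t)

indicator : Bool → ℕ
indicator true  = 1
indicator false = 0

count : {n : ℕ} → (Fin n → Bool) → ℕ
count f = sum (indicator ∘ f)

countFin≡count : {n : ℕ} (f : Fin n → Bool) → countFin n f ≡ count f
countFin≡count {n} f = count-tabulate id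
  where
  count-tabulate : ∀ {k} (h : Fin k → Fin n) →
                   List.length (List.filter (λ x → f x Bool.≟ true) (List.tabulate h)) ≡ count (f ∘ h)
  count-tabulate {zero}  h = refl
  count-tabulate {suc k} h with f (h zero)
  ... | true  = cong suc (count-tabulate (h ∘ suc))
  ... | false = count-tabulate (h ∘ suc)

∃T↔Fin-count : {n : ℕ} (f : Fin n → Bool) → ∃ (T ∘ f) ↔ Fin (count f)
∃T↔Fin-count {zero}  f = mk↔ₛ′ (λ ()) (λ ()) (λ ()) (λ ())
∃T↔Fin-count {suc n} f =
  ↔-sym Fin.+↔⊎ ↔-∘ ((T↔Fin-indicator (f zero) ⊎-↔ ∃T↔Fin-count (f ∘ suc)) ↔-∘ split-zero)
  where
  T↔Fin-indicator : (b : Bool) → T b ↔ Fin (indicator b)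
  T↔Fin-indicator true  = mk↔ₛ′ (λ _ → zero) _ (λ { zero → refl }) (λ _ → refl)
  T↔Fin-indicator false = mk↔ₛ′ (λ ()) (λ ()) (λ ()) (λ ())
  split-zero : ∃ (T ∘ f) ↔ (T (f zero) ⊎ ∃ (T ∘ f ∘ suc))
  split-zero = mk↔ₛ′ (λ { (zero , t) → inj₁ t ; (suc x , t) → inj₂ (x , t) })
                     (λ { (inj₁ t) → zero , t ; (inj₂ (x , t)) → suc x , t })
                     (λ { (inj₁ t) → refl ; (inj₂ _) → refl })
                     (λ { (zero , _) → refl ; (suc _ , _) → refl })

count-≡⇒↔ : {n : ℕ} {f g : Fin n → Bool} → count f ≡ count g → ∃ (T ∘ f) ↔ ∃ (T ∘ g)
count-≡⇒↔ {f = f} {g} f≡g = ↔-sym (∃T↔Fin-count g) ↔-∘ subst (λ c → ∃ (T ∘ f) ↔ Fin c) f≡g (∃T↔Fin-count f)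

sum-reindex : {n : ℕ} (σ : Perm n) (h : Fin n → ℕ) → sum (h ∘ app σ) ≡ sum h
sum-reindex σ h = sym (sum-permute h (permutation (app σ) (app (σ ⁻¹)) (⁻¹-inverseʳ σ) (⁻¹-inverseˡ σ)))

count-reindex : {n : ℕ} (σ : Perm n) {f g : Fin n → Bool} → (∀ x → f x ≡ g (app σ x)) → count f ≡ count g
count-reindex σ {f} {g} f≗g∘σ = trans (sum-cong-≗ (cong indicator ∘ f≗g∘σ)) (sum-reindex σ (indicator ∘ g))

sum-allFin : {n : ℕ} (h : Fin n → ℕ) → listSum (List.map h (allFin n)) ≡ sum h
sum-allFin h = trans (cong listSum (List.map-tabulate id h)) (sum-tabulate h)
  where
  sum-tabulate : ∀ {k} (g : Fin k → ℕ) → listSum (List.tabulate g) ≡ sum g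
  sum-tabulate {zero}  g = refl
  sum-tabulate {suc k} g = cong (g zero +_) (sum-tabulate (g ∘ suc))

m<n≤o⇒n∸[1+m]<o : ∀ {m n o} → m < n → n ≤ o → n ∸ suc m < o
m<n≤o⇒n∸[1+m]<o {m} {n} m<n n≤o =
  ℕ.≤-trans (ℕ.≤-reflexive (sym (ℕ.+-∸-assoc 1 m<n))) (ℕ.≤-trans (ℕ.m∸n≤m n m) n≤o)

module Cycles {n : ℕ} (p : Perm n) where

  iter-+ : ∀ j k x → iter p (j + k) x ≡ iter p j (iter p k x)
  iter-+ zero    k x = refl
  iter-+ (suc j) k x = cong (app p) (iter-+ j k x)

  iter-comm : ∀ j k x → iter p j (iter p k x) ≡ iter p k (iter p j x)
  iter-comm j k x = begin
    iter p j (iter p k x)  ≡⟨ iter-+ j k x ⟨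
    iter p (j + k) x       ≡⟨ cong (λ i → iter p i x) (ℕ.+-comm j k) ⟩
    iter p (k + j) x       ≡⟨ iter-+ k j x ⟩
    iter p k (iter p j x)  ∎
    where open ≡-Reasoning

  iter-injective : ∀ k → Injective _≡_ _≡_ (iter p k)
  iter-injective zero    eq = eq
  iter-injective (suc k) eq = iter-injective k (app-injective p eq)

  iter-periodic : ∀ {m x} → iter p (suc m) x ≡ x → ∀ q → iter p (q * suc m) x ≡ x
  iter-periodic         fixed zero    = refl
  iter-periodic {m} {x} fixed (suc q) = begin
    iter p (suc m + q * suc m) x           ≡⟨ iter-+ (suc m) (q * suc m) x ⟩
    iter p (suc m) (iter p (q * suc m) x)  ≡⟨ cong (iter p (suc m)) (iter-periodic fixed q) ⟩
    iter p (suc m) x                       ≡⟨ fixed ⟩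
    x                                      ∎
    where open ≡-Reasoning

  iter-mod : ∀ {m x} → iter p (suc m) x ≡ x → ∀ j → iter p j x ≡ iter p (j % suc m) x
  iter-mod {m} {x} fixed j = begin
    iter p j x                                          ≡⟨ cong (λ i → iter p i x) (m≡m%n+[m/n]*n j (suc m)) ⟩
    iter p (j % suc m + (j / suc m) * suc m) x          ≡⟨ iter-+ (j % suc m) _ x ⟩
    iter p (j % suc m) (iter p ((j / suc m) * suc m) x) ≡⟨ cong (iter p (j % suc m)) (iter-periodic fixed (j / suc m)) ⟩
    iter p (j % suc m) x                                ∎
    where open ≡-Reasoning

  iter-≡⇒periodic : ∀ {i j x} → i < j → iter p i x ≡ iter p j x → iter p (suc (j ∸ suc i)) x ≡ x
  iter-≡⇒periodic {i} {j} {x} i<j eq = sym (iter-injective i (begin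
    iter p i x                             ≡⟨ eq ⟩
    iter p j x                             ≡⟨ cong (λ k → iter p k x) (ℕ.m+[n∸m]≡n i<j) ⟨
    iter p (suc i + (j ∸ suc i)) x         ≡⟨ cong (λ k → iter p k x) (ℕ.+-suc i (j ∸ suc i)) ⟨
    iter p (i + suc (j ∸ suc i)) x         ≡⟨ iter-+ i _ x ⟩
    iter p i (iter p (suc (j ∸ suc i)) x)  ∎))
    where open ≡-Reasoning

  has-period : ∀ x → ∃ λ m → m < n × iter p (suc m) x ≡ x
  has-period x with Fin.pigeonhole (ℕ.n<1+n n) (λ i → iter p (toℕ i) x)
  ... | i , j , i<j , eq =
    toℕ j ∸ suc (toℕ i) , m<n≤o⇒n∸[1+m]<o i<j (s≤s⁻¹ (Fin.toℕ<n j)) , iter-≡⇒periodic i<j eq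

  OnCycle : ℕ → Fin n → Set
  OnCycle m x = iter p (suc m) x ≡ x × (∀ {j} → j < m → iter p (suc j) x ≢ x)

  inCycleOfLength⇔OnCycle : ∀ {m x} → T (inCycleOfLength p m x) ⇔ OnCycle m x
  inCycleOfLength⇔OnCycle {m} {x} = mk⇔ to from
    where
    aperiodic : ℕ → Bool
    aperiodic k = not (iter p (suc k) x == x)
    to : T (inCycleOfLength p m x) → OnCycle m x
    to t with fixed , below ← Equivalence.to T-∧ t =
      toWitness fixed , λ j<m → toWitnessFalse (applyUpTo⁻ id m (all⁺ aperiodic (upTo m) below) j<m)
    from : OnCycle m x → T (inCycleOfLength p m x)
    from (fixed , minimal) =
      Equivalence.from T-∧ (fromWitness fixed , all⁻ aperiodic (applyUpTo⁺₁ id m (fromWitnessFalse ∘ minimal)))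

  onCycle-unique : ∀ {m m′ x} → OnCycle m x → OnCycle m′ x → m ≡ m′
  onCycle-unique {m} {m′} (fixed , minimal) (fixed′ , minimal′) with ℕ.<-cmp m m′
  ... | tri< m<m′ _ _ = contradiction fixed (minimal′ m<m′)
  ... | tri≈ _ m≡m′ _ = m≡m′
  ... | tri> _ _ m′<m = contradiction fixed′ (minimal m′<m)

  onCycle-iter : ∀ {m x} k → OnCycle m x → OnCycle m (iter p k x)
  onCycle-iter {m} {x} k (fixed , minimal) =
    trans (iter-comm (suc m) k x) (cong (iter p k) fixed) ,
    λ {j} j<m eq → minimal j<m (iter-injective k (trans (iter-comm k (suc j) x) eq))

  iter-injective-on-cycle : ∀ {m x i j} → OnCycle m x → i < suc m → j < suc m →
                            iter p i x ≡ iter p j x → i ≡ j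
  iter-injective-on-cycle {m} {x} {i} {j} (_ , minimal) i≤m j≤m eq with ℕ.<-cmp i j
  ... | tri< i<j _ _ = contradiction (iter-≡⇒periodic i<j eq) (minimal (m<n≤o⇒n∸[1+m]<o i<j (s≤s⁻¹ j≤m)))
  ... | tri≈ _ i≡j _ = i≡j
  ... | tri> _ _ j<i = contradiction (iter-≡⇒periodic j<i (sym eq)) (minimal (m<n≤o⇒n∸[1+m]<o j<i (s≤s⁻¹ i≤m)))

  iter-≡⇒%-≡ : ∀ {m x} → OnCycle m x → ∀ j k → iter p j x ≡ iter p k x → j % suc m ≡ k % suc m
  iter-≡⇒%-≡ {m} {x} on-cycle@(fixed , _) j k eq =
    iter-injective-on-cycle on-cycle (m%n<n j (suc m)) (m%n<n k (suc m)) (begin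
      iter p (j % suc m) x   ≡⟨ iter-mod fixed j ⟨
      iter p j x             ≡⟨ eq ⟩
      iter p k x             ≡⟨ iter-mod fixed k ⟩
      iter p (k % suc m) x   ∎)
    where open ≡-Reasoning

  -- The opaque definitions below search Fin n; letting the type checker unfold them makes the later
  -- proofs intractable to check.
  opaque
    private
      Aperiodic : Fin n → Fin n → Set
      Aperiodic x i = iter p (suc (toℕ i)) x ≢ x

      least-period : ∀ x → ∃ λ i → ¬ Aperiodic x i × ((j : Fin′ i) → Aperiodic x (inject j))
      least-period x =
        Fin.¬∀⟶∃¬-smallest n (Aperiodic x) (λ i → ¬? (iter p (suc (toℕ i)) x Fin.≟ x)) nowhere-periodic
        where
        nowhere-periodic : ¬ (∀ i → Aperiodic x i)
        nowhere-periodic never with m , m<n , fixed ← has-period x =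
          never (Fin.fromℕ< m<n) (subst (λ k → iter p (suc k) x ≡ x) (sym (Fin.toℕ-fromℕ< m<n)) fixed)

    period : Fin n → ℕ
    period x = toℕ (proj₁ (least-period x))

    period<n : ∀ x → period x < n
    period<n x = Fin.toℕ<n (proj₁ (least-period x))

    onCycle-period : ∀ x → OnCycle (period x) x
    onCycle-period x with i , ¬aperiodic , minimal ← least-period x =
      decidable-stable (iter p (suc (toℕ i)) x Fin.≟ x) ¬aperiodic ,
      λ {j} j<i → subst (λ k → iter p (suc k) x ≢ x) (trans (Fin.toℕ-inject _) (Fin.toℕ-fromℕ< j<i))
                        (minimal (Fin.fromℕ< j<i))

  Reaches : Fin n → Fin n → Set
  Reaches x y = ∃ λ k → iter p k x ≡ y

  reaches-trans : ∀ {x y z} → Reaches x y → Reaches y z → Reaches x z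
  reaches-trans {x} (j , refl) (k , refl) = k + j , iter-+ k j x

  reaches-sym : ∀ {x y} → Reaches x y → Reaches y x
  reaches-sym {x} (k , refl) = k * period x , (begin
    iter p (k * period x) (iter p k x)  ≡⟨ iter-+ (k * period x) k x ⟨
    iter p (k * period x + k) x         ≡⟨ cong (λ i → iter p i x) (ℕ.+-comm (k * period x) k) ⟩
    iter p (k + k * period x) x         ≡⟨ cong (λ i → iter p i x) (ℕ.*-suc k (period x)) ⟨
    iter p (k * suc (period x)) x       ≡⟨ iter-periodic (proj₁ (onCycle-period x)) k ⟩
    x                                   ∎)
    where open ≡-Reasoning

  reaches-period : ∀ {x y} → Reaches x y → period y ≡ period x
  reaches-period (k , refl) = onCycle-unique (onCycle-period _) (onCycle-iter k (onCycle-period _))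

  reaches? : ∀ x y → Dec (Reaches x y)
  reaches? x y = map′ (λ (k , eq) → toℕ k , eq) bounded (Fin.any? (λ k → iter p (toℕ k) x Fin.≟ y))
    where
    bounded : Reaches x y → ∃ λ (k : Fin n) → iter p (toℕ k) x ≡ y
    bounded (k , eq) = Fin.fromℕ< k%<n , (begin
      iter p (toℕ (Fin.fromℕ< k%<n)) x  ≡⟨ cong (λ i → iter p i x) (Fin.toℕ-fromℕ< k%<n) ⟩
      iter p (k % suc (period x)) x     ≡⟨ iter-mod (proj₁ (onCycle-period x)) k ⟨
      iter p k x                        ≡⟨ eq ⟩
      y                                 ∎)
      where
      open ≡-Reasoning
      k%<n : k % suc (period x) < n
      k%<n = ℕ.<-≤-trans (m%n<n k (suc (period x))) (period<n x)

  opaque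
    -- The default x of fromMaybe is never used: x lies on its own orbit.
    leader : Fin n → Fin n
    leader x = fromMaybe x (find (reaches? x) (allFin n))

    private
      orbit-in-allFin : ∀ x → Any (Reaches x) (allFin n)
      orbit-in-allFin x = Any.map (0 ,_) (∈-allFin x)

    find-leader : ∀ x → find (reaches? x) (allFin n) ≡ just (leader x)
    find-leader x with z , found , _ ← find-just (reaches? x) (orbit-in-allFin x) =
      trans found (cong just (sym (cong (fromMaybe x) found)))

    reaches-leader : ∀ x → Reaches x (leader x)
    reaches-leader x with z , found , x↝z ← find-just (reaches? x) (orbit-in-allFin x) =
      subst (Reaches x) (sym (cong (fromMaybe x) found)) x↝z

    leader-cong : ∀ {x y} → Reaches x y → leader y ≡ leader x
    leader-cong {x} {y} x↝y = cong (fromMaybe y) (begin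
      find (reaches? y) (allFin n)  ≡⟨ find-cong (reaches? y) (reaches? x) same-orbit (allFin n) ⟩
      find (reaches? x) (allFin n)  ≡⟨ find-leader x ⟩
      just (leader x)               ∎)
      where
      open ≡-Reasoning
      same-orbit : ∀ z → Reaches y z ⇔ Reaches x z
      same-orbit z = mk⇔ (reaches-trans x↝y) (reaches-trans (reaches-sym x↝y))

  onCycle-leader : ∀ x → OnCycle (period x) (leader x)
  onCycle-leader x with k , x↝leader ← reaches-leader x =
    subst (OnCycle (period x)) x↝leader (onCycle-iter k (onCycle-period x))

  opaque
    position : Fin n → ℕ
    position x = proj₁ (reaches-sym (reaches-leader x)) % suc (period x)

    position<period : ∀ x → position x < suc (period x)
    position<period x = m%n<n (proj₁ (reaches-sym (reaches-leader x))) (suc (period x))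

    iter-position : ∀ x → iter p (position x) (leader x) ≡ x
    iter-position x with k , leader↝x ← reaches-sym (reaches-leader x) =
      trans (sym (iter-mod (proj₁ (onCycle-leader x)) k)) leader↝x

  position-iter : ∀ {r} → leader r ≡ r → ∀ j → position (iter p j r) ≡ j % suc (period r)
  position-iter {r} leader≡r j = begin
    position y                     ≡⟨ m<n⇒m%n≡m position<period-r ⟨
    position y % suc (period r)    ≡⟨ iter-≡⇒%-≡ (onCycle-period r) (position y) j (begin
      iter p (position y) r          ≡⟨ cong (iter p (position y)) (trans (leader-cong r↝y) leader≡r) ⟨
      iter p (position y) (leader y) ≡⟨ iter-position y ⟩
      y                              ∎) ⟩
    j % suc (period r)             ∎
    where
    open ≡-Reasoning
    y : Fin n
    y = iter p j r
    r↝y : Reaches r y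
    r↝y = j , refl
    position<period-r : position y < suc (period r)
    position<period-r = subst (λ m → position y < suc m) (reaches-period r↝y) (position<period y)

  opaque
    isLeader : ℕ → Fin n → Bool
    isLeader m x = inCycleOfLength p m x ∧ (leader x == x)

    isLeader⇔ : ∀ {m r} → T (isLeader m r) ⇔ (OnCycle m r × leader r ≡ r)
    isLeader⇔ = mk⇔
      (λ t → let on-cycle , is-leader = Equivalence.to T-∧ t
             in Equivalence.to inCycleOfLength⇔OnCycle on-cycle , toWitness is-leader)
      (λ (on-cycle , is-leader) →
         Equivalence.from T-∧ (Equivalence.from inCycleOfLength⇔OnCycle on-cycle , fromWitness is-leader))

  isLeader-leader : ∀ x → T (isLeader (period x) (leader x))
  isLeader-leader x = Equivalence.from isLeader⇔ (onCycle-leader x , leader-cong (reaches-leader x))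

  cycle-decomposition : ∀ m → ∃ (T ∘ inCycleOfLength p m) ↔ (∃ (T ∘ isLeader m) × Fin (suc m))
  cycle-decomposition m = mk↔ₛ′ to from to∘from from∘to
    where
    period≡m : ∀ {x} → T (inCycleOfLength p m x) → period x ≡ m
    period≡m t = onCycle-unique (onCycle-period _) (Equivalence.to inCycleOfLength⇔OnCycle t)
    to : ∃ (T ∘ inCycleOfLength p m) → ∃ (T ∘ isLeader m) × Fin (suc m)
    to (x , t) = (leader x , subst (λ k → T (isLeader k (leader x))) (period≡m t) (isLeader-leader x)) ,
                 Fin.fromℕ< {position x} (subst (λ k → position x < suc k) (period≡m t) (position<period x))
    from : ∃ (T ∘ isLeader m) × Fin (suc m) → ∃ (T ∘ inCycleOfLength p m)
    from ((r , t) , k) = iter p (toℕ k) r ,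
      Equivalence.from (inCycleOfLength⇔OnCycle {m}) (onCycle-iter (toℕ k) (proj₁ (Equivalence.to isLeader⇔ t)))
    to∘from : ∀ y → to (from y) ≡ y
    to∘from ((r , t) , k) with on-cycle , leader≡r ← Equivalence.to isLeader⇔ t =
      cong₂ _,_ (∃T-≡ (trans (leader-cong (toℕ k , refl)) leader≡r)) (Fin.toℕ-injective (begin
        toℕ (proj₂ (to (from ((r , t) , k))))  ≡⟨ Fin.toℕ-fromℕ< _ ⟩
        position (iter p (toℕ k) r)            ≡⟨ position-iter leader≡r (toℕ k) ⟩
        toℕ k % suc (period r)                 ≡⟨ cong (λ l → toℕ k % suc l) period≡m′ ⟩
        toℕ k % suc m                          ≡⟨ m<n⇒m%n≡m (Fin.toℕ<n k) ⟩
        toℕ k                                  ∎))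
      where
      open ≡-Reasoning
      period≡m′ : period r ≡ m
      period≡m′ = onCycle-unique (onCycle-period r) on-cycle
    from∘to : ∀ x → from (to x) ≡ x
    from∘to (x , _) =
      ∃T-≡ (trans (cong (λ k → iter p k (leader x)) (Fin.toℕ-fromℕ< {position x} _)) (iter-position x))

  cycleStructure≡count-isLeader : ∀ m → cycleStructure p m ≡ count (isLeader m)
  cycleStructure≡count-isLeader m = begin
    countFin n (inCycleOfLength p m) / suc m   ≡⟨ cong (_/ suc m) (countFin≡count (inCycleOfLength p m)) ⟩
    count (inCycleOfLength p m) / suc m        ≡⟨ cong (_/ suc m) count-decomposed ⟩
    count (isLeader m) * suc m / suc m         ≡⟨ m*n/n≡m (count (isLeader m)) (suc m) ⟩
    count (isLeader m)                         ∎
    where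
    open ≡-Reasoning
    count-decomposed : count (inCycleOfLength p m) ≡ count (isLeader m) * suc m
    count-decomposed = ↔⇒≡ (↔-sym Fin.*↔× ↔-∘ ((∃T↔Fin-count (isLeader m) ×-↔ ↔-id (Fin (suc m))) ↔-∘
                            (cycle-decomposition m ↔-∘ ↔-sym (∃T↔Fin-count (inCycleOfLength p m)))))

-- A length-preserving matching r ↦ r′ of the cycle leaders of α and β yields the conjugator α^k r ↦ β^k r′.
module LeaderMatching {n : ℕ} (α β : Perm n)
  (match : ∀ m → ∃ (T ∘ Cycles.isLeader α m) ↔ ∃ (T ∘ Cycles.isLeader β m)) where

  private
    module A = Cycles α
    module B = Cycles β

  matched : ∀ {m r} → T (A.isLeader m r) → Fin n
  matched {m} {r} t = proj₁ (Inverse.to (match m) (r , t))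

  isLeader-matched : ∀ {m r} (t : T (A.isLeader m r)) → T (B.isLeader m (matched t))
  isLeader-matched {m} {r} t = proj₂ (Inverse.to (match m) (r , t))

  matched-cong : ∀ {m m′ r r′} (t : T (A.isLeader m r)) (t′ : T (A.isLeader m′ r′)) → m ≡ m′ → r ≡ r′ →
                 matched t ≡ matched t′
  matched-cong t t′ refl refl = cong matched (T-irrelevant t t′)

  opaque
    transport : Fin n → Fin n
    transport x = iter β (A.position x) (matched (A.isLeader-leader x))

    transport-unfold : ∀ x → transport x ≡ iter β (A.position x) (matched (A.isLeader-leader x))
    transport-unfold x = refl

  transport-iter : ∀ {m r} (t : T (A.isLeader m r)) k → transport (iter α k r) ≡ iter β k (matched t)
  transport-iter {m} {r} t k = begin
    transport y                                            ≡⟨ transport-unfold y ⟩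
    iter β (A.position y) (matched (A.isLeader-leader y))  ≡⟨ cong₂ (iter β) position≡ matched≡ ⟩
    iter β (k % suc m) (matched t)                         ≡⟨ B.iter-mod matched-fixed k ⟨
    iter β k (matched t)                                   ∎
    where
    open ≡-Reasoning
    y : Fin n
    y = iter α k r
    r↝y : A.Reaches r y
    r↝y = k , refl
    on-cycle : A.OnCycle m r
    on-cycle = proj₁ (Equivalence.to A.isLeader⇔ t)
    period≡m : A.period r ≡ m
    period≡m = A.onCycle-unique (A.onCycle-period r) on-cycle
    position≡ : A.position y ≡ k % suc m
    position≡ = trans (A.position-iter (proj₂ (Equivalence.to A.isLeader⇔ t)) k) (cong (λ l → k % suc l) period≡m)
    matched≡ : matched (A.isLeader-leader y) ≡ matched t
    matched≡ = matched-cong (A.isLeader-leader y) t (trans (A.reaches-period r↝y) period≡m)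
                 (trans (A.leader-cong r↝y) (proj₂ (Equivalence.to A.isLeader⇔ t)))
    matched-fixed : iter β (suc m) (matched t) ≡ matched t
    matched-fixed = proj₁ (proj₁ (Equivalence.to B.isLeader⇔ (isLeader-matched t)))

  transport-intertwines : ∀ x → transport (app α x) ≡ app β (transport x)
  transport-intertwines x = begin
    transport (app α x)                        ≡⟨ cong (transport ∘ app α) (A.iter-position x) ⟨
    transport (iter α (suc k) (A.leader x))    ≡⟨ transport-iter {A.period x} t (suc k) ⟩
    app β (iter β k (matched t))               ≡⟨ cong (app β) (transport-iter {A.period x} t k) ⟨
    app β (transport (iter α k (A.leader x)))  ≡⟨ cong (app β ∘ transport) (A.iter-position x) ⟩
    app β (transport x)                        ∎
    where
    open ≡-Reasoning
    k : ℕ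
    k = A.position x
    t : T (A.isLeader (A.period x) (A.leader x))
    t = A.isLeader-leader x

sameCycleStructure⇒conjugate : {n : ℕ} (α β : Perm n) → (∀ m → cycleStructure α m ≡ cycleStructure β m) →
                               ∃ λ φ → Intertwines φ α β
sameCycleStructure⇒conjugate {n} α β same = φ , φ-intertwines
  where
  module A = Cycles α
  module B = Cycles β
  leaders≡ : ∀ m → count (A.isLeader m) ≡ count (B.isLeader m)
  leaders≡ m = trans (sym (A.cycleStructure≡count-isLeader m)) (trans (same m) (B.cycleStructure≡count-isLeader m))
  match : ∀ m → ∃ (T ∘ A.isLeader m) ↔ ∃ (T ∘ B.isLeader m)
  match m = count-≡⇒↔ (leaders≡ m)
  module F = LeaderMatching α β match
  module G = LeaderMatching β α (↔-sym ∘ match)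
  G∘F : ∀ x → G.transport (F.transport x) ≡ x
  G∘F x = begin
    G.transport (F.transport x)                      ≡⟨ cong (G.transport ∘ F.transport) (A.iter-position x) ⟨
    G.transport (F.transport (iter α k (A.leader x))) ≡⟨ cong G.transport (F.transport-iter {A.period x} leader k) ⟩
    G.transport (iter β k (F.matched leader))         ≡⟨ G.transport-iter {A.period x} (F.isLeader-matched leader) k ⟩
    iter α k (G.matched (F.isLeader-matched leader))  ≡⟨ cong (iter α k) matched-back ⟩
    iter α k (A.leader x)                             ≡⟨ A.iter-position x ⟩
    x                                                 ∎
    where
    open ≡-Reasoning
    k : ℕ
    k = A.position x
    leader : T (Cycles.isLeader α (Cycles.period α x) (Cycles.leader α x))
    leader = A.isLeader-leader x
    matched-back : G.matched (F.isLeader-matched leader) ≡ A.leader x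
    matched-back = cong proj₁ (Inverse.strictlyInverseʳ (match (A.period x)) (A.leader x , leader))
  φ : Perm n
  φ = fromLeftInverse F.transport G.transport G∘F
  φ-intertwines : Intertwines φ α β
  φ-intertwines x = begin
    app φ (app α x)        ≡⟨ lookup∘tabulate F.transport (app α x) ⟩
    F.transport (app α x)  ≡⟨ F.transport-intertwines x ⟩
    app β (F.transport x)  ≡⟨ cong (app β) (lookup∘tabulate F.transport x) ⟨
    app β (app φ x)        ∎
    where open ≡-Reasoning

module _ {n : ℕ} {φ α β : Perm n} (φα≡βφ : Intertwines φ α β) where

  iter-intertwines : ∀ k x → app φ (iter α k x) ≡ iter β k (app φ x)
  iter-intertwines zero    x = refl
  iter-intertwines (suc k) x = trans (φα≡βφ _) (cong (app β) (iter-intertwines k x))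

  onCycle-intertwines : ∀ {m x} → Cycles.OnCycle α m x ⇔ Cycles.OnCycle β m (app φ x)
  onCycle-intertwines {m} {x} = mk⇔
    (λ (fixed , minimal) → trans (sym (iter-intertwines (suc m) x)) (cong (app φ) fixed) ,
                           λ {j} j<m eq → minimal j<m (app-injective φ (trans (iter-intertwines (suc j) x) eq)))
    (λ (fixed , minimal) → app-injective φ (trans (iter-intertwines (suc m) x) fixed) ,
                           λ {j} j<m eq → minimal j<m (trans (sym (iter-intertwines (suc j) x)) (cong (app φ) eq)))

  intertwines⇒sameCycleStructure : ∀ m → cycleStructure α m ≡ cycleStructure β m
  intertwines⇒sameCycleStructure m = cong (_/ suc m) (begin
    countFin n (inCycleOfLength α m)  ≡⟨ countFin≡count (inCycleOfLength α m) ⟩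
    count (inCycleOfLength α m)       ≡⟨ count-reindex φ (T-injective ∘ inCycleOfLength⇔) ⟩
    count (inCycleOfLength β m)       ≡⟨ countFin≡count (inCycleOfLength β m) ⟨
    countFin n (inCycleOfLength β m)  ∎)
    where
    open ≡-Reasoning
    inCycleOfLength⇔ : ∀ x → T (inCycleOfLength α m x) ⇔ T (inCycleOfLength β m (app φ x))
    inCycleOfLength⇔ x = ⇔-sym (Cycles.inCycleOfLength⇔OnCycle β)
                           ⇔-∘ (onCycle-intertwines {m} {x} ⇔-∘ Cycles.inCycleOfLength⇔OnCycle α)

module _ {n : ℕ} where

  infix 10 _⁻¹ᵢ
  _⁻¹ᵢ : Isotopism n → Isotopism n
  (α , β , γ) ⁻¹ᵢ = α ⁻¹ , β ⁻¹ , γ ⁻¹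

  infixr 9 _∘ᵢ_
  _∘ᵢ_ : Isotopism n → Isotopism n → Isotopism n
  (α , β , γ) ∘ᵢ (α′ , β′ , γ′) = α ∘ₚ α′ , β ∘ₚ β′ , γ ∘ₚ γ′

  conjugateᵢ : Isotopism n → Isotopism n → Isotopism n
  conjugateᵢ (φ , ψ , χ) (α , β , γ) = conjugate φ α , conjugate ψ β , conjugate χ γ

  Intertwinesᵢ : Isotopism n → Isotopism n → Isotopism n → Set
  Intertwinesᵢ (φ , ψ , χ) (α , β , γ) (α′ , β′ , γ′) =
    Intertwines φ α α′ × Intertwines ψ β β′ × Intertwines χ γ γ′

  intertwinesᵢ-conjugateᵢ : (Φ Θ : Isotopism n) → Intertwinesᵢ Φ Θ (conjugateᵢ Φ Θ)
  intertwinesᵢ-conjugateᵢ (φ , ψ , χ) (α , β , γ) =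
    intertwines-conjugate φ α , intertwines-conjugate ψ β , intertwines-conjugate χ γ

  intertwinesᵢ-⁻¹ : (Φ Θ Θ′ : Isotopism n) → Intertwinesᵢ Φ Θ Θ′ → Intertwinesᵢ (Φ ⁻¹ᵢ) Θ′ Θ
  intertwinesᵢ-⁻¹ (φ , ψ , χ) (α , β , γ) (α′ , β′ , γ′) (i , j , k) =
    Equivalence.to (intertwines-⁻¹ {φ = φ} {α} {α′}) i ,
    Equivalence.to (intertwines-⁻¹ {φ = ψ} {β} {β′}) j ,
    Equivalence.to (intertwines-⁻¹ {φ = χ} {γ} {γ′}) k

  conjugateᵢ-⁻¹ˡ : (Φ Θ : Isotopism n) → conjugateᵢ (Φ ⁻¹ᵢ) (conjugateᵢ Φ Θ) ≡ Θ
  conjugateᵢ-⁻¹ˡ (φ , ψ , χ) (α , β , γ) =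
    cong₂ _,_ (conjugate-⁻¹ˡ φ α) (cong₂ _,_ (conjugate-⁻¹ˡ ψ β) (conjugate-⁻¹ˡ χ γ))

  conjugateᵢ-⁻¹ʳ : (Φ Θ : Isotopism n) → conjugateᵢ Φ (conjugateᵢ (Φ ⁻¹ᵢ) Θ) ≡ Θ
  conjugateᵢ-⁻¹ʳ (φ , ψ , χ) (α , β , γ) =
    cong₂ _,_ (conjugate-⁻¹ʳ φ α) (cong₂ _,_ (conjugate-⁻¹ʳ ψ β) (conjugate-⁻¹ʳ χ γ))

  sameCycleStructure-sym : (Θ Θ′ : Isotopism n) → SameCycleStructure Θ Θ′ → SameCycleStructure Θ′ Θ
  sameCycleStructure-sym _ _ same m with a , b , c ← same m = sym a , sym b , sym c

  sameCycleStructure-trans : (Θ Θ′ Θ″ : Isotopism n) →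
                             SameCycleStructure Θ Θ′ → SameCycleStructure Θ′ Θ″ → SameCycleStructure Θ Θ″
  sameCycleStructure-trans _ _ _ same same′ m with a , b , c ← same m | a′ , b′ , c′ ← same′ m =
    trans a a′ , trans b b′ , trans c c′

  sameCycleStructure-recompute : (Θ Θ′ : Isotopism n) → .(SameCycleStructure Θ Θ′) → SameCycleStructure Θ Θ′
  sameCycleStructure-recompute _ _ same m =
    recompute (_ ℕ.≟ _) (proj₁ (same m)) , recompute (_ ℕ.≟ _) (proj₁ (proj₂ (same m))) ,
    recompute (_ ℕ.≟ _) (proj₂ (proj₂ (same m)))

  intertwinesᵢ⇒sameCycleStructure : (Φ Θ Θ′ : Isotopism n) → Intertwinesᵢ Φ Θ Θ′ → SameCycleStructure Θ Θ′
  intertwinesᵢ⇒sameCycleStructure (φ , ψ , χ) (α , β , γ) (α′ , β′ , γ′) (i , j , k) m =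
    intertwines⇒sameCycleStructure {φ = φ} {α} {α′} i m ,
    intertwines⇒sameCycleStructure {φ = ψ} {β} {β′} j m ,
    intertwines⇒sameCycleStructure {φ = χ} {γ} {γ′} k m

  sameCycleStructure⇒conjugateᵢ : (Θ Θ′ : Isotopism n) → SameCycleStructure Θ Θ′ →
                                  ∃ λ Φ → Intertwinesᵢ Φ Θ Θ′
  sameCycleStructure⇒conjugateᵢ (α , β , γ) (α′ , β′ , γ′) same =
    (proj₁ conjα , proj₁ conjβ , proj₁ conjγ) , proj₂ conjα , proj₂ conjβ , proj₂ conjγ
    where
    conjα : ∃ λ φ → Intertwines φ α α′
    conjα = sameCycleStructure⇒conjugate α α′ λ m → proj₁ (same m)
    conjβ : ∃ λ ψ → Intertwines ψ β β′
    conjβ = sameCycleStructure⇒conjugate β β′ λ m → proj₁ (proj₂ (same m))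
    conjγ : ∃ λ χ → Intertwines χ γ γ′
    conjγ = sameCycleStructure⇒conjugate γ γ′ λ m → proj₂ (proj₂ (same m))

map-∘-≗ : {A B C : Set} {f : B → C} {g : A → B} {h : A → C} → (∀ a → f (g a) ≡ h a) →
          ∀ m → Maybe.map f (Maybe.map g m) ≡ Maybe.map h m
map-∘-≗ f∘g≗h m = trans (sym (Maybe.map-∘ m)) (Maybe.map-cong f∘g≗h m)

isFilled-map : {n : ℕ} (f : Fin n → Fin n) (m : Maybe (Fin n)) → isFilled (Maybe.map f m) ≡ isFilled m
isFilled-map f (just _) = refl
isFilled-map f nothing  = refl

module _ {n : ℕ} where

  ArrayIsotope : Isotopism n → Array n → Array n → Set
  ArrayIsotope (α , β , γ) A B = ∀ r c → cell B (app α r) (app β c) ≡ Maybe.map (app γ) (cell A r c)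

  onImage : (α β : Perm n) {P : Fin n → Fin n → Set} → (∀ x y → P (app α x) (app β y)) → ∀ r c → P r c
  onImage α β {P} P-image r c = subst₂ P (⁻¹-inverseʳ α r) (⁻¹-inverseʳ β c) (P-image _ _)

  Array-ext : {A B : Array n} → (∀ r c → cell A r c ≡ cell B r c) → A ≡ B
  Array-ext {A} {B} A≗B = begin
    A                      ≡⟨ tabulate∘lookup A ⟨
    tabulate (lookup A)    ≡⟨ tabulate-cong (λ r → begin
      lookup A r             ≡⟨ tabulate∘lookup (lookup A r) ⟨
      tabulate (cell A r)    ≡⟨ tabulate-cong (A≗B r) ⟩
      tabulate (cell B r)    ≡⟨ tabulate∘lookup (lookup B r) ⟩
      lookup B r             ∎) ⟩
    tabulate (lookup B)    ≡⟨ tabulate∘lookup B ⟩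
    B                      ∎
    where open ≡-Reasoning

  isotope-⁻¹ : (Φ : Isotopism n) {A B : Array n} → ArrayIsotope Φ A B ⇔ ArrayIsotope (Φ ⁻¹ᵢ) B A
  isotope-⁻¹ (α , β , γ) {A} {B} = mk⇔ forward backward
    where
    open ≡-Reasoning
    forward : ArrayIsotope (α , β , γ) A B → ArrayIsotope (α ⁻¹ , β ⁻¹ , γ ⁻¹) B A
    forward iso = onImage α β λ x y → begin
      cell A (app (α ⁻¹) (app α x)) (app (β ⁻¹) (app β y))
        ≡⟨ cong₂ (cell A) (⁻¹-inverseˡ α x) (⁻¹-inverseˡ β y) ⟩
      cell A x y
        ≡⟨ Maybe.map-id (cell A x y) ⟨
      Maybe.map id (cell A x y)
        ≡⟨ map-∘-≗ (⁻¹-inverseˡ γ) (cell A x y) ⟨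
      Maybe.map (app (γ ⁻¹)) (Maybe.map (app γ) (cell A x y))
        ≡⟨ cong (Maybe.map (app (γ ⁻¹))) (iso x y) ⟨
      Maybe.map (app (γ ⁻¹)) (cell B (app α x) (app β y))
        ∎
    backward : ArrayIsotope (α ⁻¹ , β ⁻¹ , γ ⁻¹) B A → ArrayIsotope (α , β , γ) A B
    backward iso x y = begin
      cell B (app α x) (app β y)
        ≡⟨ Maybe.map-id (cell B (app α x) (app β y)) ⟨
      Maybe.map id (cell B (app α x) (app β y))
        ≡⟨ map-∘-≗ (⁻¹-inverseʳ γ) (cell B (app α x) (app β y)) ⟨
      Maybe.map (app γ) (Maybe.map (app (γ ⁻¹)) (cell B (app α x) (app β y)))
        ≡⟨ cong (Maybe.map (app γ)) (iso _ _) ⟨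
      Maybe.map (app γ) (cell A (app (α ⁻¹) (app α x)) (app (β ⁻¹) (app β y)))
        ≡⟨ cong (Maybe.map (app γ)) (cong₂ (cell A) (⁻¹-inverseˡ α x) (⁻¹-inverseˡ β y)) ⟩
      Maybe.map (app γ) (cell A x y)
        ∎

  isotope-unique : (Φ : Isotopism n) {A B B′ : Array n} → ArrayIsotope Φ A B → ArrayIsotope Φ A B′ → B ≡ B′
  isotope-unique (α , β , γ) iso iso′ = Array-ext (onImage α β λ x y → trans (iso x y) (sym (iso′ x y)))

  isotope-∘ : (Φ Ψ : Isotopism n) {A B C : Array n} →
              ArrayIsotope Ψ A B → ArrayIsotope Φ B C → ArrayIsotope (Φ ∘ᵢ Ψ) A C
  isotope-∘ (α , β , γ) (α′ , β′ , γ′) {A} {B} {C} isoΨ isoΦ r c = begin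
    cell C (app (α ∘ₚ α′) r) (app (β ∘ₚ β′) c)           ≡⟨ cong₂ (cell C) (app-∘ₚ α α′ r) (app-∘ₚ β β′ c) ⟩
    cell C (app α (app α′ r)) (app β (app β′ c))         ≡⟨ isoΦ _ _ ⟩
    Maybe.map (app γ) (cell B (app α′ r) (app β′ c))     ≡⟨ cong (Maybe.map (app γ)) (isoΨ r c) ⟩
    Maybe.map (app γ) (Maybe.map (app γ′) (cell A r c))  ≡⟨ map-∘-≗ (sym ∘ app-∘ₚ γ γ′) (cell A r c) ⟩
    Maybe.map (app (γ ∘ₚ γ′)) (cell A r c)               ∎
    where open ≡-Reasoning

  autotopism-intertwines : (Φ Θ Θ′ : Isotopism n) {A B : Array n} → Intertwinesᵢ Φ Θ Θ′ →
                           ArrayIsotope Φ A B → ArrayIsotope Θ A A → ArrayIsotope Θ′ B B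
  autotopism-intertwines (φ , ψ , χ) (α , β , γ) (α′ , β′ , γ′) {A} {B} (i , j , k) iso aut =
    onImage φ ψ λ x y → begin
      cell B (app α′ (app φ x)) (app β′ (app ψ y))         ≡⟨ cong₂ (cell B) (i x) (j y) ⟨
      cell B (app φ (app α x)) (app ψ (app β y))           ≡⟨ iso _ _ ⟩
      Maybe.map (app χ) (cell A (app α x) (app β y))       ≡⟨ cong (Maybe.map (app χ)) (aut x y) ⟩
      Maybe.map (app χ) (Maybe.map (app γ) (cell A x y))   ≡⟨ map-∘-≗ k (cell A x y) ⟩
      Maybe.map (app γ′ ∘ app χ) (cell A x y)              ≡⟨ map-∘-≗ (λ _ → refl) (cell A x y) ⟨
      Maybe.map (app γ′) (Maybe.map (app χ) (cell A x y))  ≡⟨ cong (Maybe.map (app γ′)) (iso x y) ⟨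
      Maybe.map (app γ′) (cell B (app φ x) (app ψ y))      ∎
    where open ≡-Reasoning

  autotopism-⇔ : (Φ Θ Θ′ : Isotopism n) {A B : Array n} → Intertwinesᵢ Φ Θ Θ′ →
                 ArrayIsotope Φ A B → ArrayIsotope Θ A A ⇔ ArrayIsotope Θ′ B B
  autotopism-⇔ Φ Θ Θ′ {A} {B} tw iso = mk⇔
    (autotopism-intertwines Φ Θ Θ′ {A} {B} tw iso)
    (autotopism-intertwines (Φ ⁻¹ᵢ) Θ′ Θ {B} {A} (intertwinesᵢ-⁻¹ Φ Θ Θ′ tw)
                            (Equivalence.to (isotope-⁻¹ Φ {A} {B}) iso))

  isotope-IsPLS : (Φ : Isotopism n) {A B : Array n} → ArrayIsotope Φ A B → IsPLS A → IsPLS B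
  isotope-IsPLS Φ@(α , β , γ) {A} {B} iso (row-latin , column-latin) =
    (λ r c c′ s eq eq′ → app-injective (β ⁻¹) (row-latin _ _ _ _ (pull-back r c eq) (pull-back r c′ eq′))) ,
    (λ r r′ c s eq eq′ → app-injective (α ⁻¹) (column-latin _ _ _ _ (pull-back r c eq) (pull-back r′ c eq′)))
    where
    pull-back : ∀ r c {s} → cell B r c ≡ just s → cell A (app (α ⁻¹) r) (app (β ⁻¹) c) ≡ just (app (γ ⁻¹) s)
    pull-back r c eq = trans (Equivalence.to (isotope-⁻¹ Φ {A} {B}) iso r c) (cong (Maybe.map (app (γ ⁻¹))) eq)

  isotope-NonEmpty : (Φ : Isotopism n) {A B : Array n} → ArrayIsotope Φ A B → NonEmpty A → NonEmpty B
  isotope-NonEmpty (α , β , γ) iso (r , c , s , eq) =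
    app α r , app β c , app γ s , trans (iso r c) (cong (Maybe.map (app γ)) eq)

  isotopeArray : Isotopism n → Array n → Array n
  isotopeArray (α , β , γ) A = tabulate λ r → tabulate λ c → Maybe.map (app γ) (cell A (app (α ⁻¹) r) (app (β ⁻¹) c))

  isotope-isotopeArray : (Φ : Isotopism n) (A : Array n) → ArrayIsotope Φ A (isotopeArray Φ A)
  isotope-isotopeArray (α , β , γ) A r c = begin
    lookup (lookup (tabulate (tabulate ∘ entry)) (app α r)) (app β c)
      ≡⟨ cong (λ row → lookup row (app β c)) (lookup∘tabulate (tabulate ∘ entry) (app α r)) ⟩
    lookup (tabulate (entry (app α r))) (app β c)
      ≡⟨ lookup∘tabulate (entry (app α r)) (app β c) ⟩
    Maybe.map (app γ) (cell A (app (α ⁻¹) (app α r)) (app (β ⁻¹) (app β c)))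
      ≡⟨ cong (Maybe.map (app γ)) (cong₂ (cell A) (⁻¹-inverseˡ α r) (⁻¹-inverseˡ β c)) ⟩
    Maybe.map (app γ) (cell A r c)
      ∎
    where
    open ≡-Reasoning
    entry : Fin n → Fin n → Maybe (Fin n)
    entry r c = Maybe.map (app γ) (cell A (app (α ⁻¹) r) (app (β ⁻¹) c))

  act : Isotopism n → PLS n → PLS n
  act Φ (A ⟨ latin ⟩) =
    A′ ⟨ Irrelevant.map (Product.map (isotope-IsPLS Φ {A} {A′} iso) (isotope-NonEmpty Φ {A} {A′} iso)) latin ⟩
    where
    A′ : Array n
    A′ = isotopeArray Φ A
    iso : ArrayIsotope Φ A A′
    iso = isotope-isotopeArray Φ A

  isIsotope-act : (Φ : Isotopism n) (P : PLS n) → IsIsotope Φ P (act Φ P)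
  isIsotope-act Φ P = isotope-isotopeArray Φ (value P)

  isIsotope-⁻¹ : (Φ : Isotopism n) (P Q : PLS n) → IsIsotope Φ P Q → IsIsotope (Φ ⁻¹ᵢ) Q P
  isIsotope-⁻¹ Φ P Q = Equivalence.to (isotope-⁻¹ Φ {value P} {value Q})

  isIsotope-act-⁻¹ : (Φ : Isotopism n) (Q : PLS n) → IsIsotope Φ (act (Φ ⁻¹ᵢ) Q) Q
  isIsotope-act-⁻¹ Φ Q = Equivalence.from (isotope-⁻¹ Φ {value (act (Φ ⁻¹ᵢ) Q)} {value Q}) (isIsotope-act (Φ ⁻¹ᵢ) Q)

  act-⁻¹ˡ : (Φ : Isotopism n) (P : PLS n) → act (Φ ⁻¹ᵢ) (act Φ P) ≡ P
  act-⁻¹ˡ Φ P = value-injective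
    (isotope-unique (Φ ⁻¹ᵢ) {value (act Φ P)} (isIsotope-act (Φ ⁻¹ᵢ) (act Φ P))
                                             (isIsotope-⁻¹ Φ P (act Φ P) (isIsotope-act Φ P)))

  act-⁻¹ʳ : (Φ : Isotopism n) (P : PLS n) → act Φ (act (Φ ⁻¹ᵢ) P) ≡ P
  act-⁻¹ʳ Φ P = value-injective
    (isotope-unique Φ {value (act (Φ ⁻¹ᵢ) P)} (isIsotope-act Φ (act (Φ ⁻¹ᵢ) P)) (isIsotope-act-⁻¹ Φ P))

  autotopism-conjugate : (Φ Θ : Isotopism n) (P Q : PLS n) → IsIsotope Φ P Q →
                         IsAutotopism Θ P ⇔ IsAutotopism (conjugateᵢ Φ Θ) Q
  autotopism-conjugate Φ Θ P Q = autotopism-⇔ Φ Θ (conjugateᵢ Φ Θ) {value P} {value Q} (intertwinesᵢ-conjugateᵢ Φ Θ)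

  filledCount : Array n → ℕ
  filledCount A = sum λ r → count λ c → isFilled (cell A r c)

  size≡filledCount : (P : PLS n) → size P ≡ filledCount (value P)
  size≡filledCount P = trans (sum-allFin rowCount) (sum-cong-≗ λ r → countFin≡count (filled r))
    where
    filled : Fin n → Fin n → Bool
    filled r c = isFilled (cell (value P) r c)
    rowCount : Fin n → ℕ
    rowCount r = countFin n (filled r)

  filledCount-isotope : (Φ : Isotopism n) {A B : Array n} → ArrayIsotope Φ A B → filledCount B ≡ filledCount A
  filledCount-isotope (α , β , γ) {A} {B} iso = begin
    sum rowCount                                       ≡⟨ sum-reindex α rowCount ⟨
    sum (rowCount ∘ app α)                             ≡⟨ sum-cong-≗ (λ r → sym (count-reindex β (filled≡ r))) ⟩
    sum (λ r → count λ c → isFilled (cell A r c))      ∎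
    where
    open ≡-Reasoning
    rowCount : Fin n → ℕ
    rowCount r = count λ c → isFilled (cell B r c)
    filled≡ : ∀ r c → isFilled (cell A r c) ≡ isFilled (cell B (app α r) (app β c))
    filled≡ r c = sym (trans (cong isFilled (iso r c)) (isFilled-map (app γ) (cell A r c)))

  size-isotope : (Φ : Isotopism n) (P Q : PLS n) → IsIsotope Φ P Q → size Q ≡ size P
  size-isotope Φ P Q iso = begin
    size Q                 ≡⟨ size≡filledCount Q ⟩
    filledCount (value Q)  ≡⟨ filledCount-isotope Φ {value P} {value Q} iso ⟩
    filledCount (value P)  ≡⟨ size≡filledCount P ⟨
    size P                 ∎
    where open ≡-Reasoning

IsotopismInvariant : {n : ℕ} → (PLS n → Set) → Set
IsotopismInvariant {n} X = (Φ : Isotopism n) (P Q : PLS n) → IsIsotope Φ P Q → X P → X Q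

inClass-invariant : {n : ℕ} (P : PLS n) → IsotopismInvariant (InClass P)
inClass-invariant P Φ Q Q′ iso (Ψ , isoΨ) = Φ ∘ᵢ Ψ , isotope-∘ Φ Ψ {value P} {value Q} {value Q′} isoΨ iso

hasSize-invariant : {n : ℕ} (s : ℕ) → IsotopismInvariant {n} (HasSize s)
hasSize-invariant s Φ Q Q′ iso |Q|≡s = trans (size-isotope Φ Q Q′ iso) |Q|≡s

anyPLS-invariant : {n : ℕ} → IsotopismInvariant {n} AnyPLS
anyPLS-invariant _ _ _ _ _ = tt

module Incidence {n : ℕ} (Θ₀ : Isotopism n) where

  conjugateIz : Isotopism n → Iz Θ₀ → Iz Θ₀
  conjugateIz Φ Θ = conjugateᵢ Φ (value Θ) ⟨ Irrelevant.map stays (proof Θ) ⟩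
    where
    Θ′ : Isotopism n
    Θ′ = conjugateᵢ Φ (value Θ)
    stays : SameCycleStructure (value Θ) Θ₀ → SameCycleStructure Θ′ Θ₀
    stays = sameCycleStructure-trans Θ′ (value Θ) Θ₀ (sameCycleStructure-sym (value Θ) Θ′
              (intertwinesᵢ⇒sameCycleStructure Φ (value Θ) Θ′ (intertwinesᵢ-conjugateᵢ Φ (value Θ))))

  conjugateIz-⁻¹ˡ : (Φ : Isotopism n) (Θ : Iz Θ₀) → conjugateIz (Φ ⁻¹ᵢ) (conjugateIz Φ Θ) ≡ Θ
  conjugateIz-⁻¹ˡ Φ Θ = value-injective (conjugateᵢ-⁻¹ˡ Φ (value Θ))

  conjugateIz-⁻¹ʳ : (Φ : Isotopism n) (Θ : Iz Θ₀) → conjugateIz Φ (conjugateIz (Φ ⁻¹ᵢ) Θ) ≡ Θ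
  conjugateIz-⁻¹ʳ Φ Θ = value-injective (conjugateᵢ-⁻¹ʳ Φ (value Θ))

  Iz-conjugate : (Θ Θ′ : Iz Θ₀) → ∃ λ Φ → Intertwinesᵢ Φ (value Θ) (value Θ′)
  Iz-conjugate (Θ ⟨ [ same ] ⟩) (Θ′ ⟨ [ same′ ] ⟩) = sameCycleStructure⇒conjugateᵢ Θ Θ′
    (sameCycleStructure-trans Θ Θ₀ Θ′ (sameCycleStructure-recompute Θ Θ₀ same)
      (sameCycleStructure-sym Θ′ Θ₀ (sameCycleStructure-recompute Θ′ Θ₀ same′)))

  module _ {X : PLS n → Set} (invariant : IsotopismInvariant X) where

    transportPoints : (Φ Θ Θ′ : Isotopism n) → Intertwinesᵢ Φ Θ Θ′ → PointsOn X Θ → PointsOn X Θ′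
    transportPoints Φ Θ Θ′ tw (Q ⟨ on ⟩) = act Φ Q ⟨ Irrelevant.map (Product.map
      (invariant Φ Q (act Φ Q) (isIsotope-act Φ Q))
      (autotopism-intertwines Φ Θ Θ′ {value Q} {value (act Φ Q)} tw (isIsotope-act Φ Q))) on ⟩

    PointsOn-↔ : (Φ Θ Θ′ : Isotopism n) → Intertwinesᵢ Φ Θ Θ′ → PointsOn X Θ ↔ PointsOn X Θ′
    PointsOn-↔ Φ Θ Θ′ tw = mk↔ₛ′
      (transportPoints Φ Θ Θ′ tw) (transportPoints (Φ ⁻¹ᵢ) Θ′ Θ (intertwinesᵢ-⁻¹ Φ Θ Θ′ tw))
      (λ Q → value-injective (act-⁻¹ʳ Φ (value Q))) (λ Q → value-injective (act-⁻¹ˡ Φ (value Q)))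

    transportBlocks : (Φ Θ Θ′ : Isotopism n) → Intertwinesᵢ Φ Θ Θ′ → SameBlocks X Θ₀ Θ → SameBlocks X Θ₀ Θ′
    transportBlocks Φ Θ Θ′ tw (Ξ ⟨ same ⟩) = conjugateIz Φ Ξ ⟨ Irrelevant.map same-points same ⟩
      where
      same-points : (∀ Q → X Q → IsAutotopism (value Ξ) Q ⇔ IsAutotopism Θ Q) →
                    ∀ Q → X Q → IsAutotopism (conjugateᵢ Φ (value Ξ)) Q ⇔ IsAutotopism Θ′ Q
      same-points same Q x = autotopism-⇔ Φ Θ Θ′ {value Q₀} {value Q} tw iso ⇔-∘
                             (same Q₀ (invariant (Φ ⁻¹ᵢ) Q Q₀ (isIsotope-act (Φ ⁻¹ᵢ) Q) x) ⇔-∘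
                              ⇔-sym (autotopism-conjugate Φ (value Ξ) Q₀ Q iso))
        where
        Q₀ : PLS n
        Q₀ = act (Φ ⁻¹ᵢ) Q
        iso : IsIsotope Φ Q₀ Q
        iso = isIsotope-act-⁻¹ Φ Q

    SameBlocks-↔ : (Φ Θ Θ′ : Isotopism n) → Intertwinesᵢ Φ Θ Θ′ → SameBlocks X Θ₀ Θ ↔ SameBlocks X Θ₀ Θ′
    SameBlocks-↔ Φ Θ Θ′ tw = mk↔ₛ′
      (transportBlocks Φ Θ Θ′ tw) (transportBlocks (Φ ⁻¹ᵢ) Θ′ Θ (intertwinesᵢ-⁻¹ Φ Θ Θ′ tw))
      (λ Ξ → value-injective (conjugateIz-⁻¹ʳ Φ (value Ξ))) (λ Ξ → value-injective (conjugateIz-⁻¹ˡ Φ (value Ξ)))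

    uniform : Uniform X Θ₀
    uniform Θ Θ′ = PointsOn-↔ (proj₁ (Iz-conjugate Θ Θ′)) (value Θ) (value Θ′) (proj₂ (Iz-conjugate Θ Θ′))

    equalMultiplicity : EqualMultiplicity X Θ₀
    equalMultiplicity Θ Θ′ = SameBlocks-↔ (proj₁ (Iz-conjugate Θ Θ′)) (value Θ) (value Θ′) (proj₂ (Iz-conjugate Θ Θ′))

  transportBlocksOn : (Φ : Isotopism n) (Q Q′ : PLS n) → IsIsotope Φ Q Q′ → BlocksOn Θ₀ Q → BlocksOn Θ₀ Q′
  transportBlocksOn Φ Q Q′ iso (Θ ⟨ aut ⟩) =
    conjugateIz Φ Θ ⟨ Irrelevant.map (Equivalence.to (autotopism-conjugate Φ (value Θ) Q Q′ iso)) aut ⟩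

  BlocksOn-↔ : (Φ : Isotopism n) (Q Q′ : PLS n) → IsIsotope Φ Q Q′ → BlocksOn Θ₀ Q ↔ BlocksOn Θ₀ Q′
  BlocksOn-↔ Φ Q Q′ iso = mk↔ₛ′
    (transportBlocksOn Φ Q Q′ iso) (transportBlocksOn (Φ ⁻¹ᵢ) Q′ Q (isIsotope-⁻¹ Φ Q Q′ iso))
    (λ Θ → value-injective (conjugateIz-⁻¹ʳ Φ (value Θ))) (λ Θ → value-injective (conjugateIz-⁻¹ˡ Φ (value Θ)))

  regular : (P : PLS n) → Regular (InClass P) Θ₀
  regular P Q Q′ (Φ , isoΦ) (Ψ , isoΨ) =
    BlocksOn-↔ (Ψ ∘ᵢ Φ ⁻¹ᵢ) Q Q′ (isotope-∘ Ψ (Φ ⁻¹ᵢ) {value Q} {value P} {value Q′} (isIsotope-⁻¹ Φ P Q isoΦ) isoΨ)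

proposition9 : (n : ℕ) (Θ₀ : Isotopism n)
    → Σ (PLS n) (λ R → IsAutotopism Θ₀ R)
    → (P : PLS n) (s : ℕ) → 0 < s
    → (Uniform (InClass P) Θ₀ × Uniform (HasSize s) Θ₀ × Uniform AnyPLS Θ₀)
    × (EqualMultiplicity (InClass P) Θ₀ × EqualMultiplicity (HasSize s) Θ₀ × EqualMultiplicity AnyPLS Θ₀)
    × Regular (InClass P) Θ₀
proposition9 n Θ₀ _ P s _ =
  (uniform (inClass-invariant P) , uniform (hasSize-invariant s) , uniform anyPLS-invariant) ,
  (equalMultiplicity (inClass-invariant P) , equalMultiplicity (hasSize-invariant s) ,
   equalMultiplicity anyPLS-invariant) ,
  regular P
  where open Incidence Θ₀
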